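{- Let $t,p$ be positive integers, $N=\lfloor\frac{t+p-2}{p}\rfloor$, and $S_k=\{x\in\mathbb{Z}:(k-1)(t+p)+1\leq x\leq kt-1\}$ for $1\leq k\leq N$. Let $\lambda$ be a $(t,t+1,\ldots,t+p)$-core partition and set $b_{\lambda,k}=\#(\beta(\lambda)\cap S_k)$. If $1\leq k\leq N-1$ and $b_{\lambda,k+1}\neq 0$, then $b_{\lambda,k}-b_{\lambda,k+1}\geq p$.
   Context: A partition $\lambda=(\lambda_1,\ldots,\lambda_r)$ is a finite weakly decreasing sequence of positive integers. In its Young diagram, the hook length $h(i,j)$ of box $(i,j)$ is the number of boxes directly to its right, directly below it, plus the box itself. $\lambda$ is a $t$-core partition if no hook length is divisible by $t$, and a $(t_1,\ldots,t_m)$-core partition if it is a $t_i$-core for all $i$. The $\beta$-set of $\lambda$ is $\beta(\lambda)=\{h(i,1):1\leq i\leq r\}$. $\#A$ denotes cardinality. -}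

module Defs where

open import Data.Nat using (ℕ; zero; suc; _+_; _*_; _∸_; _≤_; _<_; _≤?_; _≟_; _/_)
open import Data.Nat.Divisibility using (_∣_)
open import Data.List using (List; []; _∷_; length; map; filter; upTo)
open import Data.List.Relation.Unary.Linked using (Linked)
open import Data.List.Relation.Unary.All using (All)
open import Data.List.Membership.DecPropositional _≟_ using (_∈_; _∈?_)
open import Data.Product using (_×_)
open import Relation.Nullary using (¬_)
open import Relation.Nullary.Decidable using (_×-dec_)

IsPartition : List ℕ → Set
IsPartition λs = Linked (λ a b → b ≤ a) λs × All (λ a → 1 ≤ a) λs

-- i-th part, 1-indexed; 0 outside the range 1..r.
part : List ℕ → ℕ → ℕ
part []       _             = 0
part (a ∷ as) zero          = 0
part (a ∷ as) (suc zero)    = a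
part (a ∷ as) (suc (suc i)) = part as (suc i)

conj : List ℕ → ℕ → ℕ
conj λs j = length (filter (λ a → j ≤? a) λs)

IsBox : List ℕ → ℕ → ℕ → Set
IsBox λs i j = 1 ≤ i × i ≤ length λs × 1 ≤ j × j ≤ part λs i

hook : List ℕ → ℕ → ℕ → ℕ
hook λs i j = (part λs i ∸ j) + (conj λs j ∸ i) + 1

IsCore : ℕ → List ℕ → Set
IsCore t λs = ∀ i j → IsBox λs i j → ¬ (t ∣ hook λs i j)

IsMultiCore : ℕ → ℕ → List ℕ → Set
IsMultiCore t p λs = ∀ s → t ≤ s → s ≤ t + p → IsCore s λs

beta : List ℕ → List ℕ
beta λs = map (λ i → hook λs (suc i) 1) (upTo (length λs))

-- N = ⌊(t+p-2)/p⌋ (p ≥ 1 is a hypothesis; value at p = 0 irrelevant)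
Nval : ℕ → ℕ → ℕ
Nval t zero    = 0
Nval t (suc q) = (t + suc q ∸ 2) / suc q

InS : ℕ → ℕ → ℕ → ℕ → Set
InS t p k x = (k ∸ 1) * (t + p) + 1 ≤ x × x + 1 ≤ k * t

-- b_{λ,k} = #(β(λ) ∩ S_k); all elements of S_k are < kt, so we count x ∈ {0,…,kt-1}.
bval : ℕ → ℕ → List ℕ → ℕ → ℕ
bval t p λs k =
  length (filter (λ x → (x ∈? beta λs) ×-dec
                        (((k ∸ 1) * (t + p) + 1 ≤? x) ×-dec (x + 1 ≤? k * t)))
                 (upTo (k * t)))

module Submission where

-- The one structural fact about cores that is needed is the classical
-- "hook removal" property of β-sets: if λ is an s-core (s ≥ 1) and
-- y + s ∈ β(λ), then y ∈ β(λ).  We prove it by contradiction: if y ∉ β(λ),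
-- a discrete intermediate-value argument finds the last row m (below the row
-- i with βᵢ = y + s) whose first-column hook still exceeds y, and the box of
-- row i in column j = y + m + 2 - r then has hook length exactly s.
--
-- The theorem itself is a counting argument.  Let y be the least
-- element of β(λ) ∩ S_{k+1} and write y = (t+p) + w.  Hook removal gives
--   * w, w+1, …, w+p-1 ∈ β(λ)  (remove hooks of length t+p, …, t+1), and
--   * x - t ∈ [w+p, kt) ∩ β(λ) for every x ∈ β(λ) ∩ S_{k+1}  (remove a t-hook),
-- and the window [w, kt) lies inside S_k, so b_k ≥ p + b_{k+1}.

open import Defs
open import Data.Nat
  using (ℕ; zero; suc; _+_; _*_; _∸_; _≤_; _<_; z≤n; s≤s; _≤?_; _≟_)
open import Data.Nat.Properties
open import Data.Nat.Tactic.RingSolver using (solve-∀)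
open import Data.Nat.Divisibility using (_∣_; ∣-refl)
open import Data.List using (List; []; _∷_; length; filter; applyUpTo)
open import Data.List.Properties using (filter-accept; filter-reject; filter-all)
open import Data.List.Relation.Unary.Linked using (Linked; [-]; _∷_; tail)
open import Data.List.Relation.Unary.All using (All; _∷_)
open import Data.List.Membership.Propositional.Properties
  using (∈-map⁺; ∈-map⁻; ∈-upTo⁺; ∈-upTo⁻)
open import Data.List.Membership.DecPropositional _≟_ using (_∈_; _∈?_)
open import Data.Product using (_×_; _,_; ∃-syntax)
open import Data.Sum using (_⊎_; inj₁; inj₂)
open import Data.Empty using (⊥-elim)
open import Function using (_∘_)
open import Relation.Nullary using (Dec; yes; no; ¬_)
open import Relation.Nullary.Decidable using (_×-dec_)
open import Relation.Unary using (Decidable)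
open import Relation.Binary using (tri<; tri≈; tri>)
open import Relation.Binary.PropositionalEquality

iverson : {P : Set} → Dec P → ℕ
iverson (yes _) = 1
iverson (no  _) = 0

iverson-mono : {P Q : Set} (P? : Dec P) (Q? : Dec Q) → (P → Q) → iverson P? ≤ iverson Q?
iverson-mono (yes _)  (yes _)  _   = ≤-refl
iverson-mono (no  _)  _        _   = z≤n
iverson-mono (yes p)  (no ¬q)  p→q = ⊥-elim (¬q (p→q p))

iverson-pos : {P : Set} (P? : Dec P) → P → 1 ≤ iverson P?
iverson-pos (yes _) _ = ≤-refl
iverson-pos (no ¬p) p = ⊥-elim (¬p p)

iverson-zero : {P : Set} (P? : Dec P) → ¬ P → iverson P? ≡ 0
iverson-zero (yes p) ¬p = ⊥-elim (¬p p)
iverson-zero (no  _) _  = refl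

count : {P : ℕ → Set} → Decidable P → ℕ → ℕ → ℕ
count P? a zero    = 0
count P? a (suc n) = iverson (P? a) + count P? (suc a) n

count-applyUpTo : {P : ℕ → Set} (P? : Decidable P) (f : ℕ → ℕ) (a n : ℕ) →
  (∀ i → f i ≡ a + i) → length (filter P? (applyUpTo f n)) ≡ count P? a n
count-applyUpTo P? f a zero    f≗ = refl
count-applyUpTo P? f a (suc n) f≗ =
  trans (cons (f 0) (applyUpTo (f ∘ suc) n))
        (cong₂ _+_ (cong (iverson ∘ P?) (trans (f≗ 0) (+-identityʳ a)))
                   (count-applyUpTo P? (f ∘ suc) (suc a) n (λ i → trans (f≗ (suc i)) (+-suc a i))))
  where
  cons : ∀ x xs → length (filter P? (x ∷ xs)) ≡ iverson (P? x) + length (filter P? xs)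
  cons x xs with P? x
  ... | yes _ = refl
  ... | no  _ = refl

count-split : {P : ℕ → Set} (P? : Decidable P) (a n m : ℕ) →
  count P? a (n + m) ≡ count P? a n + count P? (a + n) m
count-split P? a zero    m = cong (λ b → count P? b m) (sym (+-identityʳ a))
count-split P? a (suc n) m = begin
  iverson (P? a) + count P? (suc a) (n + m)
    ≡⟨ cong (iverson (P? a) +_) (count-split P? (suc a) n m) ⟩
  iverson (P? a) + (count P? (suc a) n + count P? (suc a + n) m)
    ≡⟨ sym (+-assoc (iverson (P? a)) _ _) ⟩
  count P? a (suc n) + count P? (suc a + n) m
    ≡⟨ cong (λ b → count P? a (suc n) + count P? b m) (sym (+-suc a n)) ⟩
  count P? a (suc n) + count P? (a + suc n) m ∎
  where open ≡-Reasoning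

count-mono : {P Q : ℕ → Set} (P? : Decidable P) (Q? : Decidable Q) (a b n : ℕ) →
  (∀ i → i < n → P (a + i) → Q (b + i)) → count P? a n ≤ count Q? b n
count-mono P? Q? a b zero    _ = z≤n
count-mono {P} {Q} P? Q? a b (suc n) P⇒Q =
  +-mono-≤ (iverson-mono (P? a) (Q? b) here) (count-mono P? Q? (suc a) (suc b) n next)
  where
  here : P a → Q b
  here pa = subst Q (+-identityʳ b) (P⇒Q 0 (s≤s z≤n) (subst P (sym (+-identityʳ a)) pa))
  next : ∀ i → i < n → P (suc a + i) → Q (suc b + i)
  next i i<n = subst Q (+-suc b i) ∘ P⇒Q (suc i) (s≤s i<n) ∘ subst P (sym (+-suc a i))

count-full : {P : ℕ → Set} (P? : Decidable P) (a n : ℕ) →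
  (∀ i → i < n → P (a + i)) → n ≤ count P? a n
count-full P? a zero    _  = z≤n
count-full {P} P? a (suc n) all =
  +-mono-≤ (iverson-pos (P? a) (subst P (+-identityʳ a) (all 0 (s≤s z≤n))))
           (count-full P? (suc a) n (λ i i<n → subst P (+-suc a i) (all (suc i) (s≤s i<n))))

count-first : {P : ℕ → Set} (P? : Decidable P) (a n : ℕ) → count P? a n ≢ 0 →
  ∃[ i ] i < n × P (a + i) × count P? a i ≡ 0
count-first P? a zero ne = ⊥-elim (ne refl)
count-first {P} P? a (suc n) ne with P? a
... | yes pa = 0 , s≤s z≤n , subst P (sym (+-identityʳ a)) pa , refl
... | no ¬pa with count-first P? (suc a) n ne
... | i , i<n , pi , none =
  suc i , s≤s i<n , subst P (sym (+-suc a i)) pi ,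
  trans (cong (_+ count P? (suc a) i) (iverson-zero (P? a) ¬pa)) none

last-above : (f : ℕ → ℕ) (y r : ℕ) → (∀ i → i < r → f i ≢ y) →
  ∀ m → m < r → y < f m →
  ∃[ m' ] m ≤ m' × m' < r × y < f m' × (suc m' ≡ r ⊎ (suc m' < r × f (suc m') < y))
last-above f y r miss m₀ m₀<r y<fm₀ = go (r ∸ suc m₀) m₀ (m+[n∸m]≡n m₀<r) y<fm₀
  where
  go : ∀ d m → suc m + d ≡ r → y < f m →
       ∃[ m' ] m ≤ m' × m' < r × y < f m' × (suc m' ≡ r ⊎ (suc m' < r × f (suc m') < y))
  go zero    m eq y<fm =
    m , ≤-refl , subst (m <_) eq (m≤m+n (suc m) 0) , y<fm , inj₁ (trans (sym (+-identityʳ (suc m))) eq)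
  go (suc d) m eq y<fm with <-cmp (f (suc m)) y
  ... | tri< below _ _ = m , ≤-refl , m<r , y<fm , inj₂ (sm<r , below)
    where
    sm<r : suc m < r
    sm<r = subst (suc m <_) eq (m<m+n (suc m) (s≤s z≤n))
    m<r : m < r
    m<r = <-trans (n<1+n m) sm<r
  ... | tri≈ _ hit _ = ⊥-elim (miss (suc m) (subst (suc m <_) eq (m<m+n (suc m) (s≤s z≤n))) hit)
  ... | tri> _ _ above with go d (suc m) (trans (sym (+-suc (suc m) d)) eq) above
  ... | m' , sm≤m' , rest = m' , ≤-trans (n≤1+n m) sm≤m' , rest

Decreasing : List ℕ → Set
Decreasing = Linked (λ a b → b ≤ a)

next-≤-head : ∀ {a as} → Decreasing (a ∷ as) → part as 1 ≤ a
next-≤-head [-]     = z≤n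
next-≤-head (b≤a ∷ _) = b≤a

part-≤-first : ∀ {λs} → Decreasing λs → ∀ i → part λs (suc i) ≤ part λs 1
part-≤-first {[]}     _   i       = z≤n
part-≤-first {a ∷ as} dec zero    = ≤-refl
part-≤-first {a ∷ as} dec (suc i) = ≤-trans (part-≤-first (tail dec) i) (next-≤-head dec)

part-antitone : ∀ {λs} → Decreasing λs → ∀ {i i'} → i ≤ i' → part λs (suc i') ≤ part λs (suc i)
part-antitone dec {zero} {i'} _ = part-≤-first dec i'
part-antitone {[]}     dec {suc i} {suc i'} _         = z≤n
part-antitone {a ∷ as} dec {suc i} {suc i'} (s≤s i≤i') = part-antitone (tail dec) i≤i'

part-pos : ∀ {λs} → All (1 ≤_) λs → ∀ i → i < length λs → 1 ≤ part λs (suc i)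
part-pos (pos ∷ _)   zero    _         = pos
part-pos (_ ∷ allp) (suc i) (s≤s i<r) = part-pos allp i i<r

part-beyond : ∀ λs i → length λs ≤ i → part λs (suc i) ≡ 0
part-beyond []       i       _         = refl
part-beyond (a ∷ as) (suc i) (s≤s r≤i) = part-beyond as i r≤i

conj-cons-≤ : ∀ j a as → j ≤ a → conj (a ∷ as) j ≡ suc (conj as j)
conj-cons-≤ j a as j≤a = cong length (filter-accept (λ a → j ≤? a) j≤a)

conj-cons-> : ∀ j a as → a < j → conj (a ∷ as) j ≡ conj as j
conj-cons-> j a as a<j = cong length (filter-reject (λ a → j ≤? a) (<⇒≱ a<j))

conj-zero : ∀ {λs} → Decreasing λs → ∀ j → part λs 1 < j → conj λs j ≡ 0
conj-zero {[]}     _   j _   = refl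
conj-zero {a ∷ as} dec j a<j =
  trans (conj-cons-> j a as a<j) (conj-zero (tail dec) j (≤-<-trans (next-≤-head dec) a<j))

conj-exact : ∀ {λs} → Decreasing λs → ∀ j m →
  j ≤ part λs (suc m) → part λs (suc (suc m)) < j → conj λs j ≡ suc m
conj-exact {[]}     _   j m j≤ <j = ⊥-elim (<⇒≱ <j j≤)
conj-exact {a ∷ as} dec j zero    j≤a <j =
  trans (conj-cons-≤ j a as j≤a) (cong suc (conj-zero (tail dec) j <j))
conj-exact {a ∷ as} dec j (suc m) j≤ <j =
  trans (conj-cons-≤ j a as (≤-trans j≤ (part-antitone dec {0} {suc m} z≤n)))
        (cong suc (conj-exact (tail dec) j m j≤ <j))

conj-one : ∀ {λs} → All (1 ≤_) λs → conj λs 1 ≡ length λs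
conj-one allp = cong length (filter-all (λ a → 1 ≤? a) allp)

β : List ℕ → ℕ → ℕ
β λs i = hook λs (suc i) 1

β-∈ : ∀ λs i → i < length λs → β λs i ∈ beta λs
β-∈ λs i i<r = ∈-map⁺ (β λs) (∈-upTo⁺ i<r)

β-index : ∀ λs x → x ∈ beta λs → ∃[ i ] i < length λs × x ≡ β λs i
β-index λs x x∈ with ∈-map⁻ (β λs) x∈
... | i , i∈ , x≡ = i , ∈-upTo⁻ i∈ , x≡

-- β_i = λ_{i+1} + r - (i + 1), written without truncated subtraction.
β-formula : ∀ {λs} → IsPartition λs → ∀ i → i < length λs →
  β λs i + suc i ≡ part λs (suc i) + length λs
β-formula {λs} (_ , allp) i i<r = begin
  (P ∸ 1) + (conj λs 1 ∸ suc i) + 1 + suc i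
    ≡⟨ cong (λ c → (P ∸ 1) + (c ∸ suc i) + 1 + suc i) (conj-one allp) ⟩
  (P ∸ 1) + (r ∸ suc i) + 1 + suc i
    ≡⟨ regroup (P ∸ 1) (r ∸ suc i) (suc i) ⟩
  (P ∸ 1 + 1) + (r ∸ suc i + suc i)
    ≡⟨ cong₂ _+_ (m∸n+n≡m (part-pos allp i i<r)) (m∸n+n≡m i<r) ⟩
  P + r ∎
  where
  open ≡-Reasoning
  P : ℕ
  P = part λs (suc i)
  r : ℕ
  r = length λs
  regroup : ∀ a b c → a + b + 1 + c ≡ (a + 1) + (b + c)
  regroup = solve-∀

hook-via-β : ∀ {λs} → IsPartition λs → ∀ {i m j} → i < length λs → i ≤ m →
  j ≤ part λs (suc i) → conj λs j ≡ suc m →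
  hook λs (suc i) j + (length λs + j) ≡ β λs i + suc (suc m)
hook-via-β {λs} PL {i} {m} {j} i<r i≤m j≤P conj≡ = begin
  (P ∸ j) + (conj λs j ∸ suc i) + 1 + (r + j)
    ≡⟨ cong (λ c → (P ∸ j) + (c ∸ suc i) + 1 + (r + j)) conj≡ ⟩
  (P ∸ j) + (m ∸ i) + 1 + (r + j)
    ≡⟨ regroup (P ∸ j) (m ∸ i) r j ⟩
  (P ∸ j + j) + r + suc (m ∸ i)
    ≡⟨ cong (λ x → x + r + suc (m ∸ i)) (m∸n+n≡m j≤P) ⟩
  P + r + suc (m ∸ i)
    ≡⟨ cong (_+ suc (m ∸ i)) (sym (β-formula PL i i<r)) ⟩
  β λs i + suc i + suc (m ∸ i)
    ≡⟨ shift (β λs i) i (m ∸ i) ⟩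
  β λs i + suc (suc (i + (m ∸ i)))
    ≡⟨ cong (λ x → β λs i + suc (suc x)) (m+[n∸m]≡n i≤m) ⟩
  β λs i + suc (suc m) ∎
  where
  open ≡-Reasoning
  P : ℕ
  P = part λs (suc i)
  r : ℕ
  r = length λs
  regroup : ∀ a e r j → a + e + 1 + (r + j) ≡ (a + j) + r + suc e
  regroup = solve-∀
  shift : ∀ b i e → b + suc i + suc e ≡ b + suc (suc (i + e))
  shift = solve-∀

gap-bound : ∀ {λs} → IsPartition λs → ∀ {m y} →
  (suc m ≡ length λs ⊎ (suc m < length λs × β λs (suc m) < y)) →
  part λs (suc (suc m)) + length λs < y + suc (suc m)
gap-bound {λs} _ {m} {y} (inj₁ sm≡r)
  rewrite part-beyond λs (suc m) (≤-reflexive (sym sm≡r)) | sym sm≡r = m≤n+m (suc (suc m)) y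
gap-bound {λs} PL {m} {y} (inj₂ (sm<r , β<y)) =
  subst (_< y + suc (suc m)) (β-formula PL (suc m) sm<r) (+-monoˡ-< (suc (suc m)) β<y)

hook-at-gap : ∀ {λs} → IsPartition λs → ∀ {i m y} → i < length λs → i ≤ m → m < length λs →
  y < β λs m → part λs (suc (suc m)) + length λs < y + suc (suc m) →
  ∃[ j ] IsBox λs (suc i) j × hook λs (suc i) j + y ≡ β λs i
hook-at-gap {λs} PL@(dec , _) {i} {m} {y} i<r i≤m m<r y<βm gap = j , box , hook+y≡β
  where
  r : ℕ
  r = length λs
  j : ℕ
  j = y + suc (suc m) ∸ r
  r+j : r + j ≡ y + suc (suc m)
  r+j = m+[n∸m]≡n (≤-trans (m≤n+m r _) (<⇒≤ gap))
  j≤λm : j ≤ part λs (suc m)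
  j≤λm = +-cancelˡ-≤ r j _ (begin
    r + j               ≡⟨ trans r+j (+-suc y (suc m)) ⟩
    suc y + suc m       ≤⟨ +-monoˡ-≤ (suc m) y<βm ⟩
    β λs m + suc m      ≡⟨ trans (β-formula PL m m<r) (+-comm _ r) ⟩
    r + part λs (suc m) ∎)
    where open ≤-Reasoning
  λnext<j : part λs (suc (suc m)) < j
  λnext<j = +-cancelʳ-< r (part λs (suc (suc m))) j
              (subst (part λs (suc (suc m)) + r <_) (trans (sym r+j) (+-comm r j)) gap)
  j≤λi : j ≤ part λs (suc i)
  j≤λi = ≤-trans j≤λm (part-antitone dec i≤m)
  box : IsBox λs (suc i) j
  box = s≤s z≤n , i<r , ≤-trans (s≤s z≤n) λnext<j , j≤λi
  hook+y≡β : hook λs (suc i) j + y ≡ β λs i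
  hook+y≡β = +-cancelʳ-≡ (suc (suc m)) (hook λs (suc i) j + y) (β λs i) (begin
    hook λs (suc i) j + y + suc (suc m)   ≡⟨ +-assoc (hook λs (suc i) j) y (suc (suc m)) ⟩
    hook λs (suc i) j + (y + suc (suc m)) ≡⟨ cong (hook λs (suc i) j +_) (sym r+j) ⟩
    hook λs (suc i) j + (r + j)           ≡⟨ hook-via-β PL i<r i≤m j≤λi conj≡ ⟩
    β λs i + suc (suc m) ∎)
    where
    open ≡-Reasoning
    conj≡ : conj λs j ≡ suc m
    conj≡ = conj-exact dec j m j≤λm λnext<j

-- Otherwise the row i with β_i = y + s and the last row m ≥ i with β_m > y
-- produce, via `hook-at-gap`, a box of hook length exactly s.
β-hook-removal : ∀ {λs s} → IsPartition λs → 1 ≤ s → IsCore s λs →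
  ∀ y → y + s ∈ beta λs → y ∈ beta λs
β-hook-removal {λs} {s} PL 1≤s core y y+s∈ with y ∈? beta λs
... | yes y∈ = y∈
... | no  y∉ with β-index λs (y + s) y+s∈
... | i , i<r , y+s≡βi
  with last-above (β λs) y (length λs) (λ i i<r βi≡y → y∉ (subst (_∈ beta λs) βi≡y (β-∈ λs i i<r)))
                  i i<r (subst (y <_) y+s≡βi (m<m+n y 1≤s))
... | m , i≤m , m<r , y<βm , gap with hook-at-gap PL i<r i≤m m<r y<βm (gap-bound PL gap)
... | j , box , hook+y≡βi = ⊥-elim (core (suc i) j box (subst (s ∣_) (sym hook≡s) ∣-refl))
  where
  hook≡s : hook λs (suc i) j ≡ s
  hook≡s = +-cancelʳ-≡ y (hook λs (suc i) j) s (trans hook+y≡βi (trans (sym y+s≡βi) (+-comm y s)))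

-- For a (t, …, t+p)-core, an element (t+p) + w of β(λ) forces the whole run
-- w, w+1, …, w+p into β(λ): remove a hook of length t + (p - i).
β-run-below : ∀ {t p λs} → 1 ≤ t → IsPartition λs → IsMultiCore t p λs →
  ∀ w → (t + p) + w ∈ beta λs → ∀ i → i ≤ p → w + i ∈ beta λs
β-run-below {t} {p} {λs} 1≤t PL multi w top∈ i i≤p =
  β-hook-removal PL (≤-trans 1≤t (m≤m+n t (p ∸ i)))
    (multi (t + (p ∸ i)) (m≤m+n t (p ∸ i)) (+-monoʳ-≤ t (m∸n≤m p i)))
    (w + i) (subst (_∈ beta λs) split top∈)
  where
  open ≡-Reasoning
  regroup : ∀ t w i d → t + (i + d) + w ≡ w + i + (t + d)
  regroup = solve-∀
  split : (t + p) + w ≡ w + i + (t + (p ∸ i))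
  split = begin
    t + p + w             ≡⟨ cong (λ q → t + q + w) (sym (m+[n∸m]≡n i≤p)) ⟩
    t + (i + (p ∸ i)) + w ≡⟨ regroup t w i (p ∸ i) ⟩
    w + i + (t + (p ∸ i)) ∎

inβS? : ∀ t p λs k → Decidable (λ x → x ∈ beta λs × InS t p k x)
inβS? t p λs k x = (x ∈? beta λs) ×-dec (((k ∸ 1) * (t + p) + 1 ≤? x) ×-dec (x + 1 ≤? k * t))

bval-count : ∀ t p λs k → bval t p λs k ≡ count (inβS? t p λs k) 0 (k * t)
bval-count t p λs k = count-applyUpTo (inβS? t p λs k) (λ x → x) 0 (k * t) (λ _ → refl)

-- The theorem with the paper's k ≥ 1 written as suc k: if b_{λ,k+1} ≠ 0 then
-- b_{λ,k+1} + p ≤ b_{λ,k}.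
-- With y = (t+p) + w the least element of β(λ) ∩ S_{k+1} and y + n = (k+1)t:
--   b_{k+1} + p = #(β ∩ S_{k+1} ∩ [y, y+n)) + p
--              ≤ #(β ∩ [w+p, w+p+n)) + #(β ∩ [w, w+p)) = #(β ∩ [w, kt)) ≤ b_k.
b-drop : ∀ {t p λs} → 1 ≤ t → IsPartition λs → IsMultiCore t p λs → ∀ k →
  bval t p λs (suc (suc k)) ≢ 0 → bval t p λs (suc (suc k)) + p ≤ bval t p λs (suc k)
b-drop {t} {p} {λs} 1≤t PL multi k b≢0
  with count-first (inβS? t p λs (suc (suc k))) 0 (suc (suc k) * t) (b≢0 ∘ trans (bval-count t p λs (suc (suc k))))
... | y , y<U , (y∈ , y-low , _) , none-before
  with m≤n⇒∃[o]m+o≡n (≤-trans (m≤m+n (t + p) _) (≤-trans (m≤m+n _ 1) y-low))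
     | m≤n⇒∃[o]m+o≡n (<⇒≤ y<U)
... | w , tp+w≡y | n , y+n≡U = begin
  bval t p λs (suc (suc k)) + p     ≡⟨ cong (_+ p) b-next ⟩
  count Next y n + p               ≤⟨ +-mono-≤ shifted run ⟩
  count B (w + p) n + count B w p  ≡⟨ +-comm (count B (w + p) n) (count B w p) ⟩
  count B w p + count B (w + p) n  ≡⟨ sym (count-split B w p n) ⟩
  count B w (p + n)                ≤⟨ count-mono B Here w w (p + n) inside ⟩
  count Here w (p + n)             ≤⟨ m≤n+m _ (count Here 0 w) ⟩
  count Here 0 w + count Here w (p + n) ≡⟨ sym (count-split Here 0 w (p + n)) ⟩
  count Here 0 (w + (p + n))       ≡⟨ cong (count Here 0) w+p+n≡kt ⟩
  count Here 0 (suc k * t)         ≡⟨ sym (bval-count t p λs (suc k)) ⟩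
  bval t p λs (suc k) ∎
  where
  open ≤-Reasoning
  B : Decidable (_∈ beta λs)
  B x = x ∈? beta λs
  Next : Decidable (λ x → x ∈ beta λs × InS t p (suc (suc k)) x)
  Next = inβS? t p λs (suc (suc k))
  Here : Decidable (λ x → x ∈ beta λs × InS t p (suc k) x)
  Here = inβS? t p λs (suc k)
  w-low : k * (t + p) + 1 ≤ w
  w-low = +-cancelˡ-≤ (t + p) _ w
    (subst₂ _≤_ (+-assoc (t + p) (k * (t + p)) 1) (sym tp+w≡y) y-low)
  w+p+n≡kt : w + (p + n) ≡ suc k * t
  w+p+n≡kt = +-cancelˡ-≡ t (w + (p + n)) (suc k * t) (begin-equality
    t + (w + (p + n)) ≡⟨ regroup t w p n ⟩
    (t + p + w) + n   ≡⟨ cong (_+ n) tp+w≡y ⟩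
    y + n             ≡⟨ y+n≡U ⟩
    t + suc k * t ∎)
    where
    regroup : ∀ t w p n → t + (w + (p + n)) ≡ (t + p + w) + n
    regroup = solve-∀
  b-next : bval t p λs (suc (suc k)) ≡ count Next y n
  b-next = begin-equality
    bval t p λs (suc (suc k))       ≡⟨ bval-count t p λs (suc (suc k)) ⟩
    count Next 0 (suc (suc k) * t)  ≡⟨ cong (count Next 0) (sym y+n≡U) ⟩
    count Next 0 (y + n)            ≡⟨ count-split Next 0 y n ⟩
    count Next 0 y + count Next y n ≡⟨ cong (_+ count Next y n) none-before ⟩
    count Next y n ∎
  -- Removing a t-hook moves β(λ) ∩ [y, y+n) into [w+p, w+p+n).
  shifted : count Next y n ≤ count B (w + p) n
  shifted = count-mono Next B y (w + p) n λ i _ (x∈ , _) →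
    β-hook-removal PL 1≤t (multi t ≤-refl (m≤m+n t p)) (w + p + i)
      (subst (_∈ beta λs) (shift i) x∈)
    where
    shift : ∀ i → y + i ≡ w + p + i + t
    shift i = trans (cong (_+ i) (sym tp+w≡y)) (regroup t p w i)
      where
      regroup : ∀ t p w i → t + p + w + i ≡ w + p + i + t
      regroup = solve-∀
  run : p ≤ count B w p
  run = count-full B w p λ i i<p →
    β-run-below 1≤t PL multi w (subst (_∈ beta λs) (sym tp+w≡y) y∈) i (<⇒≤ i<p)
  inside : ∀ i → i < p + n → w + i ∈ beta λs → w + i ∈ beta λs × InS t p (suc k) (w + i)
  inside i i<p+n x∈ = x∈ , ≤-trans w-low (m≤m+n w i) , (begin
    w + i + 1   ≡⟨ trans (+-assoc w i 1) (cong (w +_) (+-comm i 1)) ⟩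
    w + suc i   ≤⟨ +-monoʳ-≤ w i<p+n ⟩
    w + (p + n) ≡⟨ w+p+n≡kt ⟩
    suc k * t ∎)

lemma3p2 : (t p : ℕ) → 1 ≤ t → 1 ≤ p → (λs : List ℕ) → IsPartition λs → IsMultiCore t p λs → (k : ℕ) → 1 ≤ k → k + 1 ≤ Nval t p → bval t p λs (k + 1) ≢ 0 → bval t p λs (k + 1) + p ≤ bval t p λs k
lemma3p2 t p 1≤t _ λs PL multi (suc k) _ _ b≢0 rewrite +-comm k 1 = b-drop 1≤t PL multi k b≢0
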